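{- For every finite digraph $G$, $\nu+1\le\phi_m(G)$.
   Context: $\nu$ is the maximum number of vertex-disjoint directed cycles of $G$ (loops are cycles). A Boolean network $f:\{0,1\}^n\to\{0,1\}^n$ is monotone if $x\le y\Rightarrow f(x)\le f(y)$; its interaction graph is the digraph on $[n]$ with arc $uv$ (loops allowed) iff $f_v$ depends on $x_u$; $\phi_m(G)$ is the maximum number of fixed points of a monotone Boolean network whose interaction graph is isomorphic to $G$. -}

module Defs where

open import Data.Nat using (ℕ; zero; suc; _≤_)
open import Data.Bool using (Bool; true; false; not) renaming (_≤_ to _≤ᵇ_; _≟_ to _≟ᵇ_)
open import Data.Fin using (Fin)
open import Data.Vec using (Vec; []; _∷_; lookup; _[_]%=_)
open import Data.Vec.Properties using (≡-dec)
open import Data.Vec.Relation.Binary.Pointwise.Inductive using (Pointwise)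
open import Data.List using (List; []; _∷_; _∷ʳ_; length; filter; map; concat; _++_)
open import Data.List.Relation.Unary.All using (All)
open import Data.List.Relation.Unary.Linked using (Linked)
open import Data.List.Relation.Unary.Unique.Propositional using (Unique)
open import Data.Empty using (⊥)
open import Data.Product using (Σ; ∃; _×_)
open import Data.Fin.Permutation using (Permutation′; _⟨$⟩ʳ_)
open import Function.Bundles using (_⇔_)
open import Relation.Binary.PropositionalEquality using (_≡_; _≢_)

record Digraph : Set where
  field
    n   : ℕ
    adj : Fin n → Fin n → Bool

open Digraph public

Arc : (G : Digraph) → Fin (n G) → Fin (n G) → Set
Arc G u v = adj G u v ≡ true

-- A directed cycle: a nonempty list of pairwise distinct vertices v₀ … v_{k-1}
-- with arcs v₀v₁, …, v_{k-2}v_{k-1}, v_{k-1}v₀ (k = 1 gives a loop).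
IsCycle : (G : Digraph) → List (Fin (n G)) → Set
IsCycle G []       = ⊥
IsCycle G (v ∷ vs) = Unique (v ∷ vs) × Linked (Arc G) ((v ∷ vs) ∷ʳ v)

IsCyclePacking : (G : Digraph) → List (List (Fin (n G))) → Set
IsCyclePacking G cs = All (IsCycle G) cs × Unique (concat cs)

IsNu : Digraph → ℕ → Set
IsNu G k = (∃ λ cs → IsCyclePacking G cs × length cs ≡ k)
         × (∀ cs → IsCyclePacking G cs → length cs ≤ k)

BN : ℕ → Set
BN m = Vec Bool m → Vec Bool m

Monotone : ∀ {m} → BN m → Set
Monotone f = ∀ x y → Pointwise _≤ᵇ_ x y → Pointwise _≤ᵇ_ (f x) (f y)

DependsOn : ∀ {m} → BN m → Fin m → Fin m → Set
DependsOn f u v = ∃ λ x → lookup (f x) v ≢ lookup (f (x [ u ]%= not)) v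

IGIso : (G : Digraph) → BN (n G) → Set
IGIso G f = Σ (Permutation′ (n G)) λ σ →
  ∀ u v → Arc G u v ⇔ DependsOn f (σ ⟨$⟩ʳ u) (σ ⟨$⟩ʳ v)

allStates : (m : ℕ) → List (Vec Bool m)
allStates zero    = [] ∷ []
allStates (suc m) = map (true ∷_) (allStates m) ++ map (false ∷_) (allStates m)

numFix : ∀ {m} → BN m → ℕ
numFix f = length (filter (λ x → ≡-dec _≟ᵇ_ (f x) x) (allStates _))

IsPhiM : Digraph → ℕ → Set
IsPhiM G k = (∃ λ f → Monotone f × IGIso G f × numFix f ≡ k)
           × (∀ f → Monotone f → IGIso G f → numFix f ≤ k)

-- Let C₁, …, C_ν be vertex-disjoint cycles. Give every vertex a level in {0, …, ν}:
-- the vertices of C_i get level ν + 1 − i, and the level is propagated along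
-- in-arcs by following a chosen in-neighbour ("parent") once per vertex, which ends
-- in one of the cycles or outside all of them (level 0). Then every vertex with
-- an in-arc has an in-neighbour of its own level, and only vertices with in-arcs
-- have positive level. Let v be on iff all its in-neighbours of level ≤ level v
-- are on, or some in-neighbour of larger level is on. This network is monotone,
-- depends on exactly the arcs of G, and for every k ≤ ν the configuration
-- "on iff level ≤ k" is a fixed point; these ν + 1 fixed points are distinct
-- because every level 1, …, ν is attained.
module Submission where

open import Defs
open import Data.Bool as Bool using (Bool; true; false; not; T)
open import Data.Fin as Fin using (Fin; toℕ)
open import Data.Fin.Properties using (toℕ-injective; toℕ≤n; toℕ≤pred[n]; injective⇒≤; pigeonhole; all?; any?)
open import Data.List as List using (List; []; _∷_; _∷ʳ_; _++_; length; concat; filter; map)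
open import Data.List.Membership.Propositional using (_∈_; _∉_)
open import Data.List.Membership.Propositional.Properties using (∈-++⁺ˡ; ∈-++⁺ʳ; ∈-map⁺; ∈-filter⁺; ∈-concat⁺′; ∈-concat⁻′)
open import Data.List.Relation.Binary.Permutation.Propositional using (↭-sym)
open import Data.List.Relation.Binary.Permutation.Propositional.Properties using (∈-resp-↭; ∷↭∷ʳ)
open import Data.List.Relation.Unary.All as All using (All; []; _∷_)
open import Data.List.Relation.Unary.AllPairs using (_∷_)
open import Data.List.Relation.Unary.Any using (here; there; index)
open import Data.List.Relation.Unary.Any.Properties using (lookup-index)
open import Data.List.Relation.Unary.Linked using (Linked; _∷_)
open import Data.List.Relation.Unary.Unique.Propositional using (Unique)
open import Data.Nat using (ℕ; zero; suc; _+_; _∸_; _≤_; _<_; z≤n; s≤s; _≤ᵇ_; _≤?_; _<?_)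
open import Data.Nat.Properties as ℕ using (≤-refl; ≤-reflexive; ≤-trans; ≤-antisym; ≤-pred; <⇒≤; ≤⇒≯; ≰⇒>; ≤ᵇ⇒≤; ≤⇒≤ᵇ; n<1+n; m∸n+n≡m; +-monoʳ-<; m≤n⇒m<n∨m≡n)
open import Data.Product using (∃-syntax; _×_; _,_)
open import Data.Sum using (_⊎_; inj₁; inj₂)
open import Data.Vec using (Vec; []; _∷_; lookup; tabulate; replicate; _[_]%=_)
open import Data.Vec.Properties using (≡-dec; lookup∘tabulate; tabulate∘lookup; tabulate-cong; lookup∘updateAt; lookup∘updateAt′; lookup-replicate)
import Data.Vec.Relation.Binary.Pointwise.Inductive as Pointwise
import Data.Fin.Permutation as Permutation
open import Function.Base using (_∘_)
open import Function.Bundles using (_⇔_; mk⇔; Equivalence)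
open import Function.Definitions using (Injective)
open import Relation.Binary.Definitions using (DecidableEquality)
open import Relation.Binary.PropositionalEquality using (_≡_; _≢_; refl; sym; trans; cong; cong-app; subst; ≢-sym; module ≡-Reasoning)
open import Relation.Nullary using (¬_; Dec; yes; no; does; contradiction)
open import Relation.Nullary.Decidable using (T?; _→-dec_; _×-dec_; _⊎-dec_; does-⇔; dec-true; dec-false; decidable-stable)

T-mono : ∀ {a b} → a Bool.≤ b → T a → T b
T-mono Bool.b≤b t = t

¬T-not : ∀ {b} → T b → ¬ T (not b)
¬T-not {true} _ ()

does-mono : ∀ {A B : Set} → (A → B) → (a? : Dec A) (b? : Dec B) → does a? Bool.≤ does b?
does-mono A⇒B (yes _) (yes _) = Bool.b≤b
does-mono A⇒B (yes a) (no ¬b) = contradiction (A⇒B a) ¬b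
does-mono A⇒B (no _) (yes _) = Bool.f≤t
does-mono A⇒B (no _) (no _) = Bool.b≤b

allStates-complete : ∀ m (x : Vec Bool m) → x ∈ allStates m
allStates-complete zero [] = here refl
allStates-complete (suc m) (true ∷ x) = ∈-++⁺ˡ (∈-map⁺ (true ∷_) (allStates-complete m x))
allStates-complete (suc m) (false ∷ x) =
  ∈-++⁺ʳ (map (true ∷_) (allStates m)) (∈-map⁺ (false ∷_) (allStates-complete m x))

≤-numFix : ∀ {m k} (f : BN m) (g : Fin k → Vec Bool m) →
           Injective _≡_ _≡_ g → (∀ i → f (g i) ≡ g i) → k ≤ numFix f
≤-numFix {m} f g g-injective g-fixed = injective⇒≤ position-injective
  where
  fixedPoints : List (Vec Bool m)
  fixedPoints = filter (λ x → ≡-dec Bool._≟_ (f x) x) (allStates m)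

  g∈ : ∀ i → g i ∈ fixedPoints
  g∈ i = ∈-filter⁺ (λ x → ≡-dec Bool._≟_ (f x) x) (allStates-complete m (g i)) (g-fixed i)

  position-injective : Injective _≡_ _≡_ (λ i → index (g∈ i))
  position-injective {i} {j} eq = g-injective (begin
    g i                                  ≡⟨ lookup-index (g∈ i) ⟩
    List.lookup fixedPoints (index (g∈ i)) ≡⟨ cong (List.lookup fixedPoints) eq ⟩
    List.lookup fixedPoints (index (g∈ j)) ≡⟨ lookup-index (g∈ j) ⟨
    g j                                  ∎)
    where open ≡-Reasoning

++-Unique⇒∉ : ∀ {A : Set} (xs : List A) {ys x} → Unique (xs ++ ys) → x ∈ ys → x ∉ xs
++-Unique⇒∉ (_ ∷ xs) (distinct ∷ _) x∈ys (here refl) = All.lookup distinct (∈-++⁺ʳ xs x∈ys) refl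
++-Unique⇒∉ (_ ∷ xs) (_ ∷ unique) x∈ys (there x∈xs) = ++-Unique⇒∉ xs unique x∈ys x∈xs

++-Unique⇒Uniqueʳ : ∀ {A : Set} (xs : List A) {ys} → Unique (xs ++ ys) → Unique ys
++-Unique⇒Uniqueʳ [] unique = unique
++-Unique⇒Uniqueʳ (_ ∷ xs) (_ ∷ unique) = ++-Unique⇒Uniqueʳ xs unique

module _ {A : Set} where

  predecessor : ∀ {x} (p : A) (xs : List A) → x ∈ xs → A
  predecessor p (_ ∷ _) (here _) = p
  predecessor p (y ∷ ys) (there x∈ys) = predecessor y ys x∈ys

  predecessor-∈ : ∀ {x} (p : A) (xs : List A) (x∈xs : x ∈ xs) → predecessor p xs x∈xs ∈ p ∷ xs
  predecessor-∈ p (_ ∷ _) (here _) = here refl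
  predecessor-∈ p (y ∷ ys) (there x∈ys) = there (predecessor-∈ y ys x∈ys)

  Linked-predecessor : ∀ {R : A → A → Set} {x p xs} → Linked R (p ∷ xs) →
                       (x∈xs : x ∈ xs) → R (predecessor p xs x∈xs) x
  Linked-predecessor (r ∷ _) (here refl) = r
  Linked-predecessor (_ ∷ rs) (there x∈xs) = Linked-predecessor rs x∈xs

  cyclePredecessor : ∀ {x} (c : List A) → x ∈ c → A
  cyclePredecessor (v ∷ vs) x∈c = predecessor v (vs ∷ʳ v) (∈-resp-↭ (∷↭∷ʳ v vs) x∈c)

  cyclePredecessor-∈ : ∀ {x} (c : List A) (x∈c : x ∈ c) → cyclePredecessor c x∈c ∈ c
  cyclePredecessor-∈ (v ∷ vs) x∈c with predecessor-∈ v (vs ∷ʳ v) (∈-resp-↭ (∷↭∷ʳ v vs) x∈c)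
  ... | here eq = here eq
  ... | there p∈ = ∈-resp-↭ (↭-sym (∷↭∷ʳ v vs)) p∈

IsCycle-cyclePredecessor : ∀ (G : Digraph) {x} c → IsCycle G c → (x∈c : x ∈ c) → Arc G (cyclePredecessor c x∈c) x
IsCycle-cyclePredecessor G (v ∷ vs) (_ , closedWalk) x∈c = Linked-predecessor closedWalk (∈-resp-↭ (∷↭∷ʳ v vs) x∈c)

IsCycle⇒nonempty : ∀ (G : Digraph) c → IsCycle G c → ∃[ v ] v ∈ c
IsCycle⇒nonempty G (v ∷ _) _ = v , here refl

-- The first of k lists is numbered k and the last 1, so that the members of the
-- family get the numbers 1, …, k and every other element gets 0.
module CycleNumbering {A : Set} (_≟_ : DecidableEquality A) where
  open import Data.List.Membership.DecPropositional _≟_ using (_∈?_)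

  cycleNumber : List (List A) → A → ℕ
  cycleNumber [] v = 0
  cycleNumber (c ∷ cs) v with v ∈? c
  ... | yes _ = suc (length cs)
  ... | no _ = cycleNumber cs v

  cycleNumber-here : ∀ {c cs v} → v ∈ c → cycleNumber (c ∷ cs) v ≡ suc (length cs)
  cycleNumber-here {c} {cs} {v} v∈c with v ∈? c
  ... | yes _ = refl
  ... | no v∉c = contradiction v∈c v∉c

  cycleNumber-there : ∀ {c cs v} → v ∉ c → cycleNumber (c ∷ cs) v ≡ cycleNumber cs v
  cycleNumber-there {c} {cs} {v} v∉c with v ∈? c
  ... | yes v∈c = contradiction v∈c v∉c
  ... | no _ = refl

  cycleNumber-∉ : ∀ cs {v} → v ∉ concat cs → cycleNumber cs v ≡ 0
  cycleNumber-∉ [] _ = refl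
  cycleNumber-∉ (c ∷ cs) {v} v∉ with v ∈? c
  ... | yes v∈c = contradiction (∈-++⁺ˡ v∈c) v∉
  ... | no _ = cycleNumber-∉ cs (v∉ ∘ ∈-++⁺ʳ c)

  cycleNumber-≢0⇒∈ : ∀ cs {v} → cycleNumber cs v ≢ 0 → v ∈ concat cs
  cycleNumber-≢0⇒∈ cs {v} ≢0 = decidable-stable (v ∈? concat cs) (≢0 ∘ cycleNumber-∉ cs)

  cycleNumber-cycle : ∀ {cs c v w} → Unique (concat cs) → c ∈ cs → v ∈ c → w ∈ c →
                      cycleNumber cs v ≡ cycleNumber cs w
  cycleNumber-cycle _ (here refl) v∈c w∈c = trans (cycleNumber-here v∈c) (sym (cycleNumber-here w∈c))
  cycleNumber-cycle {c₀ ∷ cs} unique (there c∈cs) v∈c w∈c = begin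
    cycleNumber (c₀ ∷ cs) _ ≡⟨ cycleNumber-there (++-Unique⇒∉ c₀ unique (∈-concat⁺′ v∈c c∈cs)) ⟩
    cycleNumber cs _        ≡⟨ cycleNumber-cycle (++-Unique⇒Uniqueʳ c₀ unique) c∈cs v∈c w∈c ⟩
    cycleNumber cs _        ≡⟨ cycleNumber-there (++-Unique⇒∉ c₀ unique (∈-concat⁺′ w∈c c∈cs)) ⟨
    cycleNumber (c₀ ∷ cs) _ ∎
    where open ≡-Reasoning

  cycleNumber-onto : ∀ cs → Unique (concat cs) → All (λ c → ∃[ v ] v ∈ c) cs →
                     ∀ i → i < length cs → ∃[ w ] cycleNumber cs w ≡ suc i
  cycleNumber-onto (c ∷ cs) unique ((v , v∈c) ∷ nonempty) i (s≤s i≤k) with m≤n⇒m<n∨m≡n i≤k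
  ... | inj₂ refl = v , cycleNumber-here v∈c
  ... | inj₁ i<k with cycleNumber-onto cs (++-Unique⇒Uniqueʳ c unique) nonempty i i<k
  ...   | w , numbered = w , trans (cycleNumber-there w∉c) numbered
    where
    w∉c : w ∉ c
    w∉c = ++-Unique⇒∉ c unique (cycleNumber-≢0⇒∈ cs (λ ≡0 → ℕ.1+n≢0 (trans (sym numbered) ≡0)))

module Iteration {N : ℕ} (f : Fin N → Fin N) where
  open import Function.Endo.Propositional (Fin N) public using (_^_)
  open import Function.Endo.Propositional (Fin N) using (^-homo)

  ^-+ : ∀ k l v → (f ^ (k + l)) v ≡ (f ^ k) ((f ^ l) v)
  ^-+ k l = cong-app (^-homo f k l)

  ^-comm : ∀ k v → (f ^ k) (f v) ≡ f ((f ^ k) v)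
  ^-comm zero v = refl
  ^-comm (suc k) v = cong f (^-comm k v)

  ^-fixed : ∀ k {v} → f v ≡ v → (f ^ k) v ≡ v
  ^-fixed zero _ = refl
  ^-fixed (suc k) fv≡v = trans (cong f (^-fixed k fv≡v)) fv≡v

  orbit-repeats : ∀ v → ∃[ m ] m ≤ N × (f ^ suc N) v ≡ (f ^ m) v
  orbit-repeats v with pigeonhole (n<1+n N) (λ j → (f ^ toℕ j) v)
  ... | i , j , i<j , fⁱv≡fʲv = d + toℕ i , d+i≤N , (begin
    (f ^ suc N) v           ≡⟨ cong (λ k → (f ^ k) v) d+j≡1+N ⟨
    (f ^ (d + toℕ j)) v     ≡⟨ ^-+ d (toℕ j) v ⟩
    (f ^ d) ((f ^ toℕ j) v) ≡⟨ cong (f ^ d) fⁱv≡fʲv ⟨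
    (f ^ d) ((f ^ toℕ i) v) ≡⟨ ^-+ d (toℕ i) v ⟨
    (f ^ (d + toℕ i)) v     ∎)
    where
    open ≡-Reasoning
    d : ℕ
    d = suc N ∸ toℕ j
    d+j≡1+N : d + toℕ j ≡ suc N
    d+j≡1+N = m∸n+n≡m (toℕ≤n j)
    d+i≤N : d + toℕ i ≤ N
    d+i≤N = ≤-pred (subst (d + toℕ i <_) d+j≡1+N (+-monoʳ-< d i<j))

  -- Labels are read with 0 meaning "unlabelled"; f must keep every positive label.
  module _ (label : Fin N → ℕ) (f-preserves : ∀ v → label v ≢ 0 → label (f v) ≡ label v) where

    ^-preserves : ∀ k v → label v ≢ 0 → label ((f ^ k) v) ≡ label v
    ^-preserves zero v _ = refl
    ^-preserves (suc k) v ≢0 = trans (f-preserves _ (subst (_≢ 0) (sym preserved) ≢0)) preserved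
      where
      preserved : label ((f ^ k) v) ≡ label v
      preserved = ^-preserves k v ≢0

    unlabelled-before : ∀ {m v} → m ≤ N → label ((f ^ N) v) ≡ 0 → label ((f ^ m) v) ≡ 0
    unlabelled-before {m} {v} m≤N ≡0 = decidable-stable (label ((f ^ m) v) ℕ.≟ 0) λ ≢0 → ≢0 (begin
      label ((f ^ m) v)                ≡⟨ ^-preserves (N ∸ m) _ ≢0 ⟨
      label ((f ^ (N ∸ m)) ((f ^ m) v)) ≡⟨ cong label (^-+ (N ∸ m) m v) ⟨
      label ((f ^ (N ∸ m + m)) v)       ≡⟨ cong (λ k → label ((f ^ k) v)) (m∸n+n≡m m≤N) ⟩
      label ((f ^ N) v)                 ≡⟨ ≡0 ⟩
      0                                 ∎)
      where open ≡-Reasoning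

    -- By pigeonhole the orbit returns within N steps, so after N steps it has
    -- either reached a label it keeps or can never reach one.
    limit-invariant : ∀ v → label ((f ^ N) (f v)) ≡ label ((f ^ N) v)
    limit-invariant v with label ((f ^ N) v) ℕ.≟ 0 | orbit-repeats v
    ... | no ≢0 | _ = trans (cong label (^-comm N v)) (f-preserves _ ≢0)
    ... | yes ≡0 | m , m≤N , f¹⁺ᴺv≡fᵐv = begin
      label ((f ^ N) (f v)) ≡⟨ cong label (trans (^-comm N v) f¹⁺ᴺv≡fᵐv) ⟩
      label ((f ^ m) v)     ≡⟨ unlabelled-before m≤N ≡0 ⟩
      0                     ≡⟨ ≡0 ⟨
      label ((f ^ N) v)     ∎
      where open ≡-Reasoning

record Levelling (G : Digraph) : Set where
  field
    level    : Fin (n G) → ℕ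
    grounded : ∀ v → level v ≡ 0 ⊎ ∃[ u ] Arc G u v
    inherit  : ∀ {u v} → Arc G u v → ∃[ p ] Arc G p v × level p ≡ level v

arc? : ∀ (G : Digraph) u v → Dec (Arc G u v)
arc? G u v = adj G u v Bool.≟ true

module LevelNetwork {G : Digraph} (L : Levelling G) where
  open Levelling L

  On : Vec Bool (n G) → Fin (n G) → Set
  On x u = T (lookup x u)

  Fires : Vec Bool (n G) → Fin (n G) → Set
  Fires x v = (∀ u → Arc G u v → level u ≤ level v → On x u)
            ⊎ (∃[ u ] Arc G u v × level v < level u × On x u)

  fires? : ∀ x v → Dec (Fires x v)
  fires? x v = all? (λ u → arc? G u v →-dec level u ≤? level v →-dec T? (lookup x u))
         ⊎-dec any? (λ u → arc? G u v ×-dec level v <? level u ×-dec T? (lookup x u))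

  network : BN (n G)
  network x = tabulate λ v → does (fires? x v)

  lookup-network : ∀ x v → lookup (network x) v ≡ does (fires? x v)
  lookup-network x v = lookup∘tabulate (λ w → does (fires? x w)) v

  Fires-resp : ∀ {v} x y → (∀ u → Arc G u v → On x u → On y u) → Fires x v → Fires y v
  Fires-resp _ _ x⇒y (inj₁ all-on) = inj₁ λ u a le → x⇒y u a (all-on u a le)
  Fires-resp _ _ x⇒y (inj₂ (u , a , lt , on)) = inj₂ (u , a , lt , x⇒y u a on)

  network-monotone : Monotone network
  network-monotone x y x≤y = Pointwise.tabulate⁺ λ v →
    does-mono (Fires-resp x y λ u _ → T-mono (Pointwise.lookup x≤y u)) (fires? x v) (fires? y v)

  network-fixed : ∀ {x} → (∀ v → Fires x v ⇔ On x v) → network x ≡ x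
  network-fixed {x} fires⇔on = begin
    tabulate (λ v → does (fires? x v)) ≡⟨ tabulate-cong (λ v → does-⇔ (fires⇔on v) (fires? x v) (T? (lookup x v))) ⟩
    tabulate (lookup x)                ≡⟨ tabulate∘lookup x ⟩
    x                                  ∎
    where open ≡-Reasoning

  network-separates : ∀ {v} x y → Fires x v → ¬ Fires y v → lookup (network x) v ≢ lookup (network y) v
  network-separates {v} x y fx ¬fy eq = contradiction (begin
    true                    ≡⟨ dec-true (fires? x v) fx ⟨
    does (fires? x v)       ≡⟨ lookup-network x v ⟨
    lookup (network x) v    ≡⟨ eq ⟩
    lookup (network y) v    ≡⟨ lookup-network y v ⟩
    does (fires? y v)       ≡⟨ dec-false (fires? y v) ¬fy ⟩
    false                   ∎) λ ()
    where open ≡-Reasoning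

  levelState : ℕ → Vec Bool (n G)
  levelState k = tabulate λ u → level u ≤ᵇ k

  On-levelState⁺ : ∀ {k u} → level u ≤ k → On (levelState k) u
  On-levelState⁺ {k} {u} le = subst T (sym (lookup∘tabulate _ u)) (≤⇒≤ᵇ le)

  On-levelState⁻ : ∀ {k u} → On (levelState k) u → level u ≤ k
  On-levelState⁻ {k} {u} on = ≤ᵇ⇒≤ (level u) k (subst T (lookup∘tabulate _ u) on)

  Fires-levelState : ∀ {k v} → Fires (levelState k) v ⇔ On (levelState k) v
  Fires-levelState {k} {v} = mk⇔ (On-levelState⁺ ∘ fires⇒≤) (inj₁ ∘ ≤⇒all-on ∘ On-levelState⁻)
    where
    ≤⇒all-on : level v ≤ k → ∀ u → Arc G u v → level u ≤ level v → On (levelState k) u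
    ≤⇒all-on lv≤k u _ lu≤lv = On-levelState⁺ (≤-trans lu≤lv lv≤k)

    fires⇒≤ : Fires (levelState k) v → level v ≤ k
    fires⇒≤ (inj₂ (u , _ , lv<lu , on)) = ≤-trans (<⇒≤ lv<lu) (On-levelState⁻ on)
    fires⇒≤ (inj₁ all-on) with grounded v
    ... | inj₁ ≡0 = subst (_≤ k) (sym ≡0) z≤n
    ... | inj₂ (_ , a) with inherit a
    ...   | p , ap , lp≡lv = subst (_≤ k) lp≡lv (On-levelState⁻ (all-on p ap (≤-reflexive lp≡lv)))

  levelState-fixed : ∀ k → network (levelState k) ≡ levelState k
  levelState-fixed k = network-fixed (λ v → Fires-levelState)

  Fires-flip-nonarc : ∀ {u v} x → ¬ Arc G u v → Fires x v ⇔ Fires (x [ u ]%= not) v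
  Fires-flip-nonarc {u} {v} x ¬arc =
    mk⇔ (Fires-resp x (x [ u ]%= not) λ w a → subst T (sym (agree w a))) (Fires-resp (x [ u ]%= not) x λ w a → subst T (agree w a))
    where
    agree : ∀ w → Arc G w v → lookup (x [ u ]%= not) w ≡ lookup x w
    agree w a = lookup∘updateAt′ w u (λ { refl → ¬arc a }) x

  depends⇒arc : ∀ {u v} → DependsOn network u v → Arc G u v
  depends⇒arc {u} {v} (x , differs) = decidable-stable (arc? G u v) λ ¬arc → differs (begin
    lookup (network x) v               ≡⟨ lookup-network x v ⟩
    does (fires? x v)                  ≡⟨ does-⇔ (Fires-flip-nonarc x ¬arc) (fires? x v) (fires? y v) ⟩
    does (fires? y v)                  ≡⟨ lookup-network y v ⟨
    lookup (network y) v               ∎)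
    where
    open ≡-Reasoning
    y = x [ u ]%= not

  -- Flipping an in-neighbour u of v changes v: from the state "on iff level ≤ level v"
  -- when level u ≤ level v, and from the all-off state otherwise.
  arc⇒depends : ∀ {u v} → Arc G u v → DependsOn network u v
  arc⇒depends {u} {v} a with level u ≤? level v
  ... | yes lu≤lv = x , network-separates x (x [ u ]%= not) (Equivalence.from Fires-levelState (On-levelState⁺ ≤-refl)) ¬fires
    where
    x = levelState (level v)
    x-on-u : On x u
    x-on-u = On-levelState⁺ lu≤lv
    ¬fires : ¬ Fires (x [ u ]%= not) v
    ¬fires (inj₁ all-on) = ¬T-not x-on-u (subst T (lookup∘updateAt u x) (all-on u a lu≤lv))
    ¬fires (inj₂ (w , _ , lv<lw , on)) with w Fin.≟ u
    ... | yes refl = ≤⇒≯ lu≤lv lv<lw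
    ... | no w≢u = ≤⇒≯ (On-levelState⁻ (subst T (lookup∘updateAt′ w u w≢u x) on)) lv<lw
  ... | no lu≰lv = x , ≢-sym (network-separates (x [ u ]%= not) x fires ¬fires)
    where
    x = replicate (n G) false
    off : ∀ w → ¬ On x w
    off w on = subst T (lookup-replicate w false) on
    fires : Fires (x [ u ]%= not) v
    fires = inj₂ (u , a , ≰⇒> lu≰lv , subst T (sym (trans (lookup∘updateAt u x) (cong not (lookup-replicate u false)))) _)
    ¬fires : ¬ Fires x v
    ¬fires (inj₂ (w , _ , _ , on)) = off w on
    ¬fires (inj₁ all-on) with inherit a
    ... | p , ap , lp≡lv = off p (all-on p ap (≤-reflexive lp≡lv))

  network-IGIso : IGIso G network
  network-IGIso = Permutation.id , λ u v → mk⇔ arc⇒depends depends⇒arc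

  module _ {ν : ℕ} (reaches : ∀ i → i < ν → ∃[ w ] level w ≡ suc i) where

    levelState-≡⇒≥ : ∀ {a b} → b ≤ ν → levelState a ≡ levelState b → b ≤ a
    levelState-≡⇒≥ {b = zero} _ _ = z≤n
    levelState-≡⇒≥ {a} {suc i} b≤ν eq with reaches i b≤ν
    ... | w , lw≡b = subst (_≤ a) lw≡b
      (On-levelState⁻ (subst (λ x → On x w) (sym eq) (On-levelState⁺ (≤-reflexive lw≡b))))

    suc-ν≤numFix : suc ν ≤ numFix network
    suc-ν≤numFix = ≤-numFix network (levelState ∘ toℕ) injective (levelState-fixed ∘ toℕ)
      where
      injective : Injective _≡_ _≡_ (levelState ∘ toℕ)
      injective {i} {j} eq = toℕ-injective
        (≤-antisym (levelState-≡⇒≥ (toℕ≤pred[n] i) (sym eq)) (levelState-≡⇒≥ (toℕ≤pred[n] j) eq))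

module PackingLevelling (G : Digraph) (cs : List (List (Fin (n G))))
                        (cycles : All (IsCycle G) cs) (disjoint : Unique (concat cs)) where
  open CycleNumbering (Fin._≟_ {n G})
  open import Data.List.Membership.DecPropositional (Fin._≟_ {n G}) using (_∈?_)

  number : Fin (n G) → ℕ
  number = cycleNumber cs

  packingPredecessor : ∀ {v} → v ∈ concat cs → Fin (n G)
  packingPredecessor v∈ = let c , v∈c , _ = ∈-concat⁻′ cs v∈ in cyclePredecessor c v∈c

  packingPredecessor-arc : ∀ {v} (v∈ : v ∈ concat cs) → Arc G (packingPredecessor v∈) v
  packingPredecessor-arc v∈ = let c , v∈c , c∈cs = ∈-concat⁻′ cs v∈ in
    IsCycle-cyclePredecessor G c (All.lookup cycles c∈cs) v∈c

  packingPredecessor-number : ∀ {v} (v∈ : v ∈ concat cs) → number (packingPredecessor v∈) ≡ number v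
  packingPredecessor-number v∈ = let c , v∈c , c∈cs = ∈-concat⁻′ cs v∈ in
    cycleNumber-cycle disjoint c∈cs (cyclePredecessor-∈ c v∈c) v∈c

  hasInArc? : ∀ v → Dec (∃[ u ] Arc G u v)
  hasInArc? v = any? λ u → arc? G u v

  parent : Fin (n G) → Fin (n G)
  parent v with hasInArc? v
  ... | no _ = v
  ... | yes (u , _) with v ∈? concat cs
  ...   | yes v∈ = packingPredecessor v∈
  ...   | no _ = u

  parent-arc : ∀ {u v} → Arc G u v → Arc G (parent v) v
  parent-arc {u} {v} a with hasInArc? v
  ... | no none = contradiction (u , a) none
  ... | yes (u′ , a′) with v ∈? concat cs
  ...   | yes v∈ = packingPredecessor-arc v∈
  ...   | no _ = a′

  parent-number : ∀ v → number v ≢ 0 → number (parent v) ≡ number v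
  parent-number v ≢0 with hasInArc? v
  ... | no _ = refl
  ... | yes _ with v ∈? concat cs
  ...   | yes v∈ = packingPredecessor-number v∈
  ...   | no v∉ = contradiction (cycleNumber-≢0⇒∈ cs ≢0) v∉

  parent-source : ∀ v → ¬ (∃[ u ] Arc G u v) → parent v ≡ v
  parent-source v none with hasInArc? v
  ... | no _ = refl
  ... | yes some = contradiction some none

  open Iteration parent

  levelling : Levelling G
  levelling = record { level = level ; grounded = grounded ; inherit = inherit }
    where
    level : Fin (n G) → ℕ
    level v = number ((parent ^ n G) v)

    grounded : ∀ v → level v ≡ 0 ⊎ ∃[ u ] Arc G u v
    grounded v with hasInArc? v
    ... | yes some = inj₂ some
    ... | no none = inj₁ (trans (cong number (^-fixed (n G) (parent-source v none)))
                               (cycleNumber-∉ cs λ v∈ → none (_ , packingPredecessor-arc v∈)))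

    inherit : ∀ {u v} → Arc G u v → ∃[ p ] Arc G p v × level p ≡ level v
    inherit {v = v} a = parent v , parent-arc a , limit-invariant number parent-number v

  open Levelling levelling using (level)

  levelling-reaches : ∀ i → i < length cs → ∃[ w ] level w ≡ suc i
  levelling-reaches i i<k with cycleNumber-onto cs disjoint (All.map (IsCycle⇒nonempty G _) cycles) i i<k
  ... | w , numbered = w , trans (^-preserves number parent-number (n G) w (λ ≡0 → ℕ.1+n≢0 (trans (sym numbered) ≡0))) numbered

lemma6 : (G : Digraph) (ν φ : ℕ) → IsNu G ν → IsPhiM G φ → suc ν ≤ φ
lemma6 G _ φ ((cs , (cycles , disjoint) , refl) , _) (_ , φ-maximal) =
  ≤-trans (suc-ν≤numFix levelling-reaches) (φ-maximal network network-monotone network-IGIso)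
  where
  open PackingLevelling G cs cycles disjoint
  open LevelNetwork levelling
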